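{- For all integers $N\geq 0$ and $h\geq 1$, \[ C_{N,N+h}(q)=\sum_{k=0}^{\lfloor (h-1)/2\rfloor} C_{N,k}(q)\sum_{j=k}^{h-k-1} q^{k(N+k+1)+j(N+j+1)}\begin{bmatrix} h-1\\ 2k\end{bmatrix}\begin{bmatrix} h-2k-1\\ j-k\end{bmatrix}. \]
   Context: For a non-negative integer $n$, $[n]=\frac{1-q^n}{1-q}$, $[n]!=[1][2]\cdots[n]$, $[0]!=1$. For integers $N,K$, $\begin{bmatrix} N\\ K\end{bmatrix}=\frac{[N]!}{[K]![N-K]!}$ if $0\le K\le N$ and $0$ otherwise. For non-negative integers $m,n$, $C_{m,n}(q)=\frac{[2m+1]!\,[2n]!}{[m+n+1]!\,[m]!\,[n]!}$. -}

module Defs where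

open import Data.Nat as ℕ using (ℕ; zero; suc; _≤?_; _∸_)
open import Data.Integer as ℤ using (ℤ; 0ℤ; 1ℤ)
open import Data.List using (List; []; _∷_; map; replicate; _++_; upTo; foldr)
open import Relation.Nullary using (yes; no)
open import Relation.Binary.PropositionalEquality using (_≡_)

-- Polynomials in q with integer coefficients, as coefficient lists
-- (constant term first).  Equality is coefficientwise (trailing zeros ignored).
Poly : Set
Poly = List ℤ

infixl 6 _+P_
infixl 7 _*P_

_+P_ : Poly → Poly → Poly
[] +P g = g
(a ∷ f) +P [] = a ∷ f
(a ∷ f) +P (b ∷ g) = (a ℤ.+ b) ∷ (f +P g)

_*P_ : Poly → Poly → Poly
[] *P g = []
(a ∷ f) *P g = map (a ℤ.*_) g +P (0ℤ ∷ (f *P g))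

negP : Poly → Poly
negP = map (λ x → ℤ.- x)

coeff : Poly → ℕ → ℤ
coeff [] i = 0ℤ
coeff (a ∷ f) zero = a
coeff (a ∷ f) (suc i) = coeff f i

_≈P_ : Poly → Poly → Set
f ≈P g = ∀ i → coeff f i ≡ coeff g i

oneP : Poly
oneP = 1ℤ ∷ []

qpow : ℕ → Poly
qpow n = replicate n 0ℤ ++ (1ℤ ∷ [])

-- Rational functions in q: formal fractions num/den of polynomials
-- (all denominators arising below are nonzero polynomials).
record Frac : Set where
  constructor _/_
  field
    num : Poly
    den : Poly
open Frac public

infixl 6 _+F_
infixl 7 _*F_ _÷F_

_+F_ : Frac → Frac → Frac
(a / b) +F (c / d) = ((a *P d) +P (c *P b)) / (b *P d)

_*F_ : Frac → Frac → Frac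
(a / b) *F (c / d) = (a *P c) / (b *P d)

_÷F_ : Frac → Frac → Frac
(a / b) ÷F (c / d) = (a *P d) / (b *P c)

infix 4 _≈F_
_≈F_ : Frac → Frac → Set
(a / b) ≈F (c / d) = (a *P d) ≈P (c *P b)

zeroF oneF : Frac
zeroF = [] / oneP
oneF = oneP / oneP

qF : ℕ → Frac
qF n = qpow n / oneP

qint : ℕ → Frac
qint n = (oneP +P negP (qpow n)) / (oneP +P negP (qpow 1))

qfact : ℕ → Frac
qfact zero = oneF
qfact (suc n) = qfact n *F qint (suc n)

qbinom : ℕ → ℕ → Frac
qbinom N K with K ≤? N
... | yes _ = qfact N ÷F (qfact K *F qfact (N ∸ K))
... | no _ = zeroF

Cq : ℕ → ℕ → Frac
Cq m n = (qfact (2 ℕ.* m ℕ.+ 1) *F qfact (2 ℕ.* n))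
         ÷F ((qfact (m ℕ.+ n ℕ.+ 1) *F qfact m) *F qfact n)

-- Σ_{i=a}^{b} f i  (empty if b < a)
sumF : ℕ → ℕ → (ℕ → Frac) → Frac
sumF a b f = foldr _+F_ zeroF (map (λ i → f (a ℕ.+ i)) (upTo (suc b ∸ a)))

module Submission where

-- Put h = m + 1 and r = N + m + 1, and let
--   T(k,j) = q^(k(N+1+k) + j(N+1+j)) [r, N+1+j] [m-j, k] [j+N+1, N+1+k]   (term N m k j).
-- Clearing factorials, the (k,j) summand on the right is [2N+1]! [m]! / ([N]! [r]!) times T(k,j),
-- and T vanishes outside the triangle k ≤ j ≤ m - k, so the right side is that factor times the
-- sum of T over the square k, j ≤ m. Summing over k first is an instance of q-Vandermonde and
-- leaves q^(j(N+1+j)) [r, j] [r, N+1+j]; summing that over j is q-Vandermonde again and gives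
-- [2r, m]. Since [2r]! = [m]! [N+r+1]! [2r, m], this is C_{N,r}.
-- Everything is done in ℤ[q]: a rational function identity is its cross-multiplied polynomial
-- identity, and q-factorials can be cancelled because their constant term is 1.

open import Defs
open import Algebra.Bundles using (CommutativeRing)
open import Data.Empty using (⊥-elim)
open import Data.Integer as ℤ using (ℤ; 0ℤ; 1ℤ)
import Data.Integer.Properties as ℤ
open import Algebra.Properties.CommutativeSemigroup ℤ.+-commutativeSemigroup
  using () renaming (interchange to +-interchange)
open import Data.List using ([]; _∷_; map; foldr; applyUpTo)
open import Data.Maybe as Maybe using (Maybe; just; nothing)
open import Data.Nat using (ℕ; zero; suc; _+_; _*_; _∸_; _≤_; _<_; z≤n; s≤s; s≤s⁻¹; _≤?_; ⌊_/2⌋)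
import Data.Nat.Properties as ℕ
import Data.Nat.Tactic.RingSolver as ℕ-Solver
open import Data.Product using (_×_; _,_; proj₂)
open import Data.Sum using (inj₁; inj₂; [_,_]′)
open import Function using (_∘_; id; case_of_)
open import Relation.Binary.PropositionalEquality
import Relation.Binary.Reasoning.Setoid as SetoidReasoning
open import Relation.Nullary using (¬_; yes; no)
open import Tactic.RingSolver using (solve-∀)
open import Tactic.RingSolver.Core.AlmostCommutativeRing using (AlmostCommutativeRing; fromCommutativeRing)

-- A record around _≈P_, so that both polynomials can be inferred from a proof.
infix 4 _≈_
record _≈_ (f g : Poly) : Set where
  constructor coeffwise
  field coeff-≡ : f ≈P g
open _≈_

≈-refl : ∀ {f} → f ≈ f
≈-refl = coeffwise λ _ → refl

≈-sym : ∀ {f g} → f ≈ g → g ≈ f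
≈-sym p = coeffwise λ i → sym (coeff-≡ p i)

≈-trans : ∀ {f g h} → f ≈ g → g ≈ h → f ≈ h
≈-trans p q = coeffwise λ i → trans (coeff-≡ p i) (coeff-≡ q i)

≡⇒≈ : ∀ {f g} → f ≡ g → f ≈ g
≡⇒≈ refl = ≈-refl

scale : ℤ → Poly → Poly
scale a = map (a ℤ.*_)

coeff-+P : ∀ f g i → coeff (f +P g) i ≡ coeff f i ℤ.+ coeff g i
coeff-+P [] g i = sym (ℤ.+-identityˡ _)
coeff-+P (a ∷ f) [] i = sym (ℤ.+-identityʳ _)
coeff-+P (a ∷ f) (b ∷ g) zero = refl
coeff-+P (a ∷ f) (b ∷ g) (suc i) = coeff-+P f g i

coeff-negP : ∀ f i → coeff (negP f) i ≡ ℤ.- coeff f i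
coeff-negP [] i = refl
coeff-negP (a ∷ f) zero = refl
coeff-negP (a ∷ f) (suc i) = coeff-negP f i

coeff-scale : ∀ a f i → coeff (scale a f) i ≡ a ℤ.* coeff f i
coeff-scale a [] i = sym (ℤ.*-zeroʳ a)
coeff-scale a (b ∷ f) zero = refl
coeff-scale a (b ∷ f) (suc i) = coeff-scale a f i

module _ where
  open ≡-Reasoning

  +P-cong : ∀ {f f′ g g′} → f ≈ f′ → g ≈ g′ → f +P g ≈ f′ +P g′
  +P-cong {f} {f′} {g} {g′} p q = coeffwise λ i → begin
    coeff (f +P g) i            ≡⟨ coeff-+P f g i ⟩
    coeff f i ℤ.+ coeff g i     ≡⟨ cong₂ ℤ._+_ (coeff-≡ p i) (coeff-≡ q i) ⟩
    coeff f′ i ℤ.+ coeff g′ i   ≡⟨ coeff-+P f′ g′ i ⟨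
    coeff (f′ +P g′) i          ∎

  negP-cong : ∀ {f f′} → f ≈ f′ → negP f ≈ negP f′
  negP-cong {f} {f′} p = coeffwise λ i → begin
    coeff (negP f) i    ≡⟨ coeff-negP f i ⟩
    ℤ.- coeff f i       ≡⟨ cong ℤ.-_ (coeff-≡ p i) ⟩
    ℤ.- coeff f′ i      ≡⟨ coeff-negP f′ i ⟨
    coeff (negP f′) i   ∎

  scale-cong : ∀ a {f f′} → f ≈ f′ → scale a f ≈ scale a f′
  scale-cong a {f} {f′} p = coeffwise λ i → begin
    coeff (scale a f) i    ≡⟨ coeff-scale a f i ⟩
    a ℤ.* coeff f i        ≡⟨ cong (a ℤ.*_) (coeff-≡ p i) ⟩
    a ℤ.* coeff f′ i       ≡⟨ coeff-scale a f′ i ⟨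
    coeff (scale a f′) i   ∎

  +P-assoc : ∀ f g h → (f +P g) +P h ≈ f +P (g +P h)
  +P-assoc f g h = coeffwise λ i → begin
    coeff ((f +P g) +P h) i                    ≡⟨ coeff-+P (f +P g) h i ⟩
    coeff (f +P g) i ℤ.+ coeff h i             ≡⟨ cong (ℤ._+ coeff h i) (coeff-+P f g i) ⟩
    (coeff f i ℤ.+ coeff g i) ℤ.+ coeff h i    ≡⟨ ℤ.+-assoc (coeff f i) _ _ ⟩
    coeff f i ℤ.+ (coeff g i ℤ.+ coeff h i)    ≡⟨ cong (ℤ._+_ (coeff f i)) (coeff-+P g h i) ⟨
    coeff f i ℤ.+ coeff (g +P h) i             ≡⟨ coeff-+P f (g +P h) i ⟨
    coeff (f +P (g +P h)) i                    ∎

  +P-comm : ∀ f g → f +P g ≈ g +P f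
  +P-comm f g = coeffwise λ i → begin
    coeff (f +P g) i          ≡⟨ coeff-+P f g i ⟩
    coeff f i ℤ.+ coeff g i   ≡⟨ ℤ.+-comm (coeff f i) _ ⟩
    coeff g i ℤ.+ coeff f i   ≡⟨ coeff-+P g f i ⟨
    coeff (g +P f) i          ∎

  +P-inverseˡ : ∀ f → negP f +P f ≈ []
  +P-inverseˡ f = coeffwise λ i → begin
    coeff (negP f +P f) i          ≡⟨ coeff-+P (negP f) f i ⟩
    coeff (negP f) i ℤ.+ coeff f i ≡⟨ cong (ℤ._+ coeff f i) (coeff-negP f i) ⟩
    ℤ.- coeff f i ℤ.+ coeff f i    ≡⟨ ℤ.+-inverseˡ (coeff f i) ⟩
    0ℤ                             ∎

  +P-interchange : ∀ a b c d → (a +P b) +P (c +P d) ≈ (a +P c) +P (b +P d)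
  +P-interchange a b c d = coeffwise λ i → begin
    coeff ((a +P b) +P (c +P d)) i                      ≡⟨ coeff-+P (a +P b) _ i ⟩
    coeff (a +P b) i ℤ.+ coeff (c +P d) i               ≡⟨ cong₂ ℤ._+_ (coeff-+P a b i) (coeff-+P c d i) ⟩
    (coeff a i ℤ.+ coeff b i) ℤ.+ (coeff c i ℤ.+ coeff d i) ≡⟨ +-interchange (coeff a i) _ _ _ ⟩
    (coeff a i ℤ.+ coeff c i) ℤ.+ (coeff b i ℤ.+ coeff d i) ≡⟨ cong₂ ℤ._+_ (coeff-+P a c i) (coeff-+P b d i) ⟨
    coeff (a +P c) i ℤ.+ coeff (b +P d) i               ≡⟨ coeff-+P (a +P c) _ i ⟨
    coeff ((a +P c) +P (b +P d)) i                      ∎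

  scale-+P : ∀ a f g → scale a (f +P g) ≈ scale a f +P scale a g
  scale-+P a f g = coeffwise λ i → begin
    coeff (scale a (f +P g)) i                ≡⟨ coeff-scale a (f +P g) i ⟩
    a ℤ.* coeff (f +P g) i                    ≡⟨ cong (a ℤ.*_) (coeff-+P f g i) ⟩
    a ℤ.* (coeff f i ℤ.+ coeff g i)           ≡⟨ ℤ.*-distribˡ-+ a (coeff f i) _ ⟩
    a ℤ.* coeff f i ℤ.+ a ℤ.* coeff g i       ≡⟨ cong₂ ℤ._+_ (coeff-scale a f i) (coeff-scale a g i) ⟨
    coeff (scale a f) i ℤ.+ coeff (scale a g) i ≡⟨ coeff-+P (scale a f) (scale a g) i ⟨
    coeff (scale a f +P scale a g) i          ∎

  scale-distrib : ∀ a b f → scale (a ℤ.+ b) f ≈ scale a f +P scale b f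
  scale-distrib a b f = coeffwise λ i → begin
    coeff (scale (a ℤ.+ b) f) i                 ≡⟨ coeff-scale (a ℤ.+ b) f i ⟩
    (a ℤ.+ b) ℤ.* coeff f i                     ≡⟨ ℤ.*-distribʳ-+ (coeff f i) a b ⟩
    a ℤ.* coeff f i ℤ.+ b ℤ.* coeff f i         ≡⟨ cong₂ ℤ._+_ (coeff-scale a f i) (coeff-scale b f i) ⟨
    coeff (scale a f) i ℤ.+ coeff (scale b f) i ≡⟨ coeff-+P (scale a f) (scale b f) i ⟨
    coeff (scale a f +P scale b f) i            ∎

  scale-scale : ∀ a b f → scale a (scale b f) ≈ scale (a ℤ.* b) f
  scale-scale a b f = coeffwise λ i → begin
    coeff (scale a (scale b f)) i  ≡⟨ coeff-scale a (scale b f) i ⟩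
    a ℤ.* coeff (scale b f) i      ≡⟨ cong (a ℤ.*_) (coeff-scale b f i) ⟩
    a ℤ.* (b ℤ.* coeff f i)        ≡⟨ ℤ.*-assoc a b (coeff f i) ⟨
    a ℤ.* b ℤ.* coeff f i          ≡⟨ coeff-scale (a ℤ.* b) f i ⟨
    coeff (scale (a ℤ.* b) f) i    ∎

+P-congˡ : ∀ f {g g′} → g ≈ g′ → f +P g ≈ f +P g′
+P-congˡ f = +P-cong (≈-refl {f})

+P-congʳ : ∀ g {f f′} → f ≈ f′ → f +P g ≈ f′ +P g
+P-congʳ g f≈f′ = +P-cong f≈f′ (≈-refl {g})

+P-identityʳ : ∀ f → f +P [] ≈ f
+P-identityʳ [] = ≈-refl
+P-identityʳ (a ∷ f) = ≈-refl

scale-zero : ∀ f → scale 0ℤ f ≈ []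
scale-zero f = coeffwise (coeff-scale 0ℤ f)

scale-one : ∀ f → scale 1ℤ f ≈ f
scale-one f = coeffwise λ i → trans (coeff-scale 1ℤ f i) (ℤ.*-identityˡ _)

∷-cong : ∀ {a b f g} → a ≡ b → f ≈ g → (a ∷ f) ≈ (b ∷ g)
∷-cong a≡b f≈g = coeffwise λ { zero → a≡b ; (suc i) → coeff-≡ f≈g i }

0∷-≈[] : ∀ {f} → f ≈ [] → (0ℤ ∷ f) ≈ []
0∷-≈[] f≈0 = coeffwise λ { zero → refl ; (suc i) → coeff-≡ f≈0 i }

∷-injective : ∀ {a b f g} → (a ∷ f) ≈ (b ∷ g) → a ≡ b × f ≈ g
∷-injective p = coeff-≡ p zero , coeffwise λ i → coeff-≡ p (suc i)

0∷-*P : ∀ f g → (0ℤ ∷ f) *P g ≈ (0ℤ ∷ (f *P g))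
0∷-*P f g = +P-cong (scale-zero g) ≈-refl

*P-zeroʳ : ∀ f → f *P [] ≈ []
*P-zeroʳ [] = ≈-refl
*P-zeroʳ (a ∷ f) = 0∷-≈[] (*P-zeroʳ f)

*P-zeroˡ-≈ : ∀ {f} g → f ≈ [] → f *P g ≈ []
*P-zeroˡ-≈ {[]} g f≈0 = ≈-refl
*P-zeroˡ-≈ {a ∷ f} g f≈0 with ∷-injective (≈-trans f≈0 (≈-sym (0∷-≈[] ≈-refl)))
... | refl , f≈[] = ≈-trans (0∷-*P f g) (0∷-≈[] (*P-zeroˡ-≈ g f≈[]))

*P-congʳ : ∀ {f f′} g → f ≈ f′ → f *P g ≈ f′ *P g
*P-congʳ {[]} {[]} g p = ≈-refl
*P-congʳ {[]} {b ∷ f′} g p = ≈-sym (*P-zeroˡ-≈ g (≈-sym p))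
*P-congʳ {a ∷ f} {[]} g p = *P-zeroˡ-≈ g p
*P-congʳ {a ∷ f} {b ∷ f′} g p with ∷-injective p
... | refl , f≈f′ = +P-cong ≈-refl (∷-cong refl (*P-congʳ g f≈f′))

*P-congˡ : ∀ f {g g′} → g ≈ g′ → f *P g ≈ f *P g′
*P-congˡ [] p = ≈-refl
*P-congˡ (a ∷ f) p = +P-cong (scale-cong a p) (∷-cong refl (*P-congˡ f p))

*P-zeroʳ-≈ : ∀ f {g} → g ≈ [] → f *P g ≈ []
*P-zeroʳ-≈ f g≈0 = ≈-trans (*P-congˡ f g≈0) (*P-zeroʳ f)

*P-zero-middle : ∀ x {y} z → y ≈ [] → x *P y *P z ≈ []
*P-zero-middle x z y≈0 = *P-zeroˡ-≈ z (*P-zeroʳ-≈ x y≈0)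

*P-distribʳ : ∀ h f g → (f +P g) *P h ≈ f *P h +P g *P h
*P-distribʳ h [] g = ≈-refl
*P-distribʳ h (a ∷ f) [] = ≈-sym (+P-identityʳ _)
*P-distribʳ h (a ∷ f) (b ∷ g) =
  ≈-trans (+P-cong (scale-distrib a b h) (∷-cong (ℤ.+-identityʳ 0ℤ) (*P-distribʳ h f g)))
          (+P-interchange (scale a h) (scale b h) (0ℤ ∷ (f *P h)) (0ℤ ∷ (g *P h)))

*P-distribˡ : ∀ f g h → f *P (g +P h) ≈ f *P g +P f *P h
*P-distribˡ [] g h = ≈-refl
*P-distribˡ (a ∷ f) g h =
  ≈-trans (+P-cong (scale-+P a g h) (∷-cong (ℤ.+-identityʳ 0ℤ) (*P-distribˡ f g h)))
          (+P-interchange (scale a g) (scale a h) (0ℤ ∷ (f *P g)) (0ℤ ∷ (f *P h)))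

scale-*P : ∀ a f g → scale a f *P g ≈ scale a (f *P g)
scale-*P a [] g = ≈-refl
scale-*P a (b ∷ f) g =
  ≈-trans (+P-cong (≈-sym (scale-scale a b g)) (∷-cong (sym (ℤ.*-zeroʳ a)) (scale-*P a f g)))
          (≈-sym (scale-+P a (scale b g) (0ℤ ∷ (f *P g))))

*P-assoc : ∀ f g h → (f *P g) *P h ≈ f *P (g *P h)
*P-assoc [] g h = ≈-refl
*P-assoc (a ∷ f) g h =
  ≈-trans (*P-distribʳ h (scale a g) (0ℤ ∷ (f *P g)))
          (+P-cong (scale-*P a g h) (≈-trans (0∷-*P (f *P g) h) (∷-cong refl (*P-assoc f g h))))

*P-∷ : ∀ f b g → f *P (b ∷ g) ≈ scale b f +P (0ℤ ∷ (f *P g))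
*P-∷ [] b g = ≈-sym (0∷-≈[] ≈-refl)
*P-∷ (a ∷ f) b g = ∷-cong (cong (ℤ._+ 0ℤ) (ℤ.*-comm a b))
  (≈-trans (+P-congˡ (scale a g) (*P-∷ f b g)) (+P-exchange (scale a g) (scale b f) (0ℤ ∷ (f *P g))))
  where
  +P-exchange : ∀ x y z → x +P (y +P z) ≈ y +P (x +P z)
  +P-exchange x y z = ≈-trans (≈-sym (+P-assoc x y z)) (≈-trans (+P-congʳ z (+P-comm x y)) (+P-assoc y x z))

*P-comm : ∀ f g → f *P g ≈ g *P f
*P-comm [] g = ≈-sym (*P-zeroʳ g)
*P-comm (a ∷ f) g = ≈-sym (≈-trans (*P-∷ g a f) (+P-cong ≈-refl (∷-cong refl (*P-comm g f))))

*P-identityˡ : ∀ f → oneP *P f ≈ f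
*P-identityˡ f = ≈-trans (+P-cong (scale-one f) (0∷-≈[] ≈-refl)) (+P-identityʳ f)

polyCommutativeRing : CommutativeRing _ _
polyCommutativeRing = record
  { Carrier = Poly ; _≈_ = _≈_ ; _+_ = _+P_ ; _*_ = _*P_ ; -_ = negP ; 0# = [] ; 1# = oneP
  ; isCommutativeRing = record
    { isRing = record
      { +-isAbelianGroup = record
        { isGroup = record
          { isMonoid = record
            { isSemigroup = record
              { isMagma = record
                { isEquivalence = record { refl = ≈-refl ; sym = ≈-sym ; trans = ≈-trans }
                ; ∙-cong = +P-cong }
              ; assoc = +P-assoc }
            ; identity = (λ _ → ≈-refl) , +P-identityʳ }
          ; inverse = +P-inverseˡ , λ f → ≈-trans (+P-comm f (negP f)) (+P-inverseˡ f)
          ; ⁻¹-cong = negP-cong }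
        ; comm = +P-comm }
      ; *-cong = λ {f} {f′} {g} {g′} p q → ≈-trans (*P-congʳ g p) (*P-congˡ f′ q)
      ; *-assoc = *P-assoc
      ; *-identity = *P-identityˡ , λ f → ≈-trans (*P-comm f oneP) (*P-identityˡ f)
      ; distrib = *P-distribˡ , *P-distribʳ }
    ; *-comm = *P-comm } }

module P = CommutativeRing polyCommutativeRing
module ≈-Reasoning = SetoidReasoning P.setoid

-- The solver cancels a monomial only when it can see that its coefficient vanishes.
[]≈? : ∀ f → Maybe ([] ≈ f)
[]≈? [] = just ≈-refl
[]≈? (ℤ.+ zero ∷ f) = Maybe.map (λ []≈f → ≈-sym (0∷-≈[] (≈-sym []≈f))) ([]≈? f)
[]≈? (ℤ.+ suc n ∷ f) = nothing
[]≈? (ℤ.-[1+ n ] ∷ f) = nothing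

polyRing : AlmostCommutativeRing _ _
polyRing = fromCommutativeRing polyCommutativeRing []≈?

record NonZeroConst (p : Poly) : Set where
  constructor nonZeroConst
  field coeff₀≢0 : ¬ coeff p 0 ≡ 0ℤ
open NonZeroConst

coeff₀-*P : ∀ f g → coeff (f *P g) 0 ≡ coeff f 0 ℤ.* coeff g 0
coeff₀-*P [] g = sym (ℤ.*-zeroˡ (coeff g 0))
coeff₀-*P (a ∷ f) g = trans (coeff-+P (scale a g) (0ℤ ∷ (f *P g)) 0)
                            (trans (ℤ.+-identityʳ _) (coeff-scale a g 0))

nonZeroConst-*P : ∀ {f g} → NonZeroConst f → NonZeroConst g → NonZeroConst (f *P g)
nonZeroConst-*P {f} {g} f₀≢0 g₀≢0 = nonZeroConst λ fg₀≡0 →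
  [ coeff₀≢0 f₀≢0 , coeff₀≢0 g₀≢0 ]′ (ℤ.i*j≡0⇒i≡0∨j≡0 (coeff f 0) (trans (sym (coeff₀-*P f g)) fg₀≡0))

nonZeroConst-oneP : NonZeroConst oneP
nonZeroConst-oneP = nonZeroConst λ ()

-- Peel off the constant term of u, which must vanish since that of h does not.
*P-noZeroDivisors : ∀ {h} → NonZeroConst h → ∀ u → u *P h ≈ [] → u ≈ []
*P-noZeroDivisors h₀≢0 [] uh≈0 = ≈-refl
*P-noZeroDivisors {h} h₀≢0 (a ∷ u) uh≈0
  with ℤ.i*j≡0⇒i≡0∨j≡0 a (trans (sym (coeff₀-*P (a ∷ u) h)) (coeff-≡ uh≈0 0))
... | inj₂ h₀≡0 = ⊥-elim (coeff₀≢0 h₀≢0 h₀≡0)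
... | inj₁ refl = 0∷-≈[] (*P-noZeroDivisors h₀≢0 u (proj₂ (∷-injective 0∷uh≈0∷[])))
  where
  0∷uh≈0∷[] : (0ℤ ∷ (u *P h)) ≈ (0ℤ ∷ [])
  0∷uh≈0∷[] = ≈-trans (≈-sym (0∷-*P u h)) (≈-trans uh≈0 (≈-sym (0∷-≈[] ≈-refl)))

*P-cancelʳ : ∀ {h} → NonZeroConst h → ∀ {f g} → f *P h ≈ g *P h → f ≈ g
*P-cancelʳ {h} h₀≢0 {f} {g} fh≈gh = begin
  f                        ≈⟨ split f g ⟩
  (f +P negP g) +P g       ≈⟨ +P-congʳ g (*P-noZeroDivisors h₀≢0 (f +P negP g) difference) ⟩
  [] +P g                  ≈⟨ P.+-identityˡ g ⟩
  g                        ∎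
  where
  open ≈-Reasoning
  split : ∀ f g → f ≈ (f +P negP g) +P g
  split = solve-∀ polyRing
  expand : ∀ f g h → (f +P negP g) *P h ≈ f *P h +P negP (g *P h)
  expand = solve-∀ polyRing
  difference : (f +P negP g) *P h ≈ []
  difference = ≈-trans (expand f g h) (≈-trans (+P-congʳ (negP (g *P h)) fh≈gh) (P.-‿inverseʳ (g *P h)))

0∷≈q*P : ∀ f → (0ℤ ∷ f) ≈ qpow 1 *P f
0∷≈q*P f = ≈-sym (≈-trans (0∷-*P oneP f) (∷-cong refl (*P-identityˡ f)))

qpow-+ : ∀ a b → qpow (a + b) ≈ qpow a *P qpow b
qpow-+ zero b = ≈-sym (*P-identityˡ _)
qpow-+ (suc a) b = ≈-trans (∷-cong refl (qpow-+ a b)) (≈-sym (0∷-*P (qpow a) (qpow b)))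

-- Multiplication by q is written as the shift 0ℤ ∷_, so that the constant term computes.
intP : ℕ → Poly
intP zero = []
intP (suc n) = oneP +P (0ℤ ∷ intP n)

intP-suc : ∀ n → intP (suc n) ≈ oneP +P qpow 1 *P intP n
intP-suc n = +P-congˡ oneP (0∷≈q*P (intP n))

intP-+ : ∀ a b → intP (a + b) ≈ intP a +P qpow a *P intP b
intP-+ zero b = ≈-sym (*P-identityˡ _)
intP-+ (suc a) b = begin
  intP (suc (a + b))                                   ≈⟨ intP-suc (a + b) ⟩
  oneP +P qpow 1 *P intP (a + b)                       ≈⟨ +P-congˡ oneP (*P-congˡ (qpow 1) (intP-+ a b)) ⟩
  oneP +P qpow 1 *P (intP a +P qpow a *P intP b)       ≈⟨ regroup (qpow 1) (intP a) (qpow a) (intP b) ⟩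
  (oneP +P qpow 1 *P intP a) +P (qpow 1 *P qpow a) *P intP b
    ≈⟨ +P-cong (≈-sym (intP-suc a)) (*P-congʳ (intP b) (≈-sym (qpow-+ 1 a))) ⟩
  intP (suc a) +P qpow (suc a) *P intP b               ∎
  where
  open ≈-Reasoning
  regroup : ∀ q x y z → oneP +P q *P (x +P y *P z) ≈ (oneP +P q *P x) +P (q *P y) *P z
  regroup = solve-∀ polyRing

intP-*-1-q : ∀ n → intP n *P (oneP +P negP (qpow 1)) ≈ oneP +P negP (qpow n)
intP-*-1-q zero = ≈-sym (0∷-≈[] ≈-refl)
intP-*-1-q (suc n) = begin
  intP (suc n) *P (oneP +P negP q)                    ≈⟨ *P-congʳ (oneP +P negP q) (intP-suc n) ⟩
  (oneP +P q *P intP n) *P (oneP +P negP q)           ≈⟨ expand q (intP n) ⟩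
  (oneP +P negP q) +P q *P (intP n *P (oneP +P negP q)) ≈⟨ +P-congˡ (oneP +P negP q) (*P-congˡ q (intP-*-1-q n)) ⟩
  (oneP +P negP q) +P q *P (oneP +P negP (qpow n))    ≈⟨ collapse q (qpow n) ⟩
  oneP +P negP (q *P qpow n)                          ≈⟨ +P-congˡ oneP (negP-cong (≈-sym (qpow-+ 1 n))) ⟩
  oneP +P negP (qpow (suc n))                         ∎
  where
  open ≈-Reasoning
  q = qpow 1
  expand : ∀ q x → (oneP +P q *P x) *P (oneP +P negP q) ≈ (oneP +P negP q) +P q *P (x *P (oneP +P negP q))
  expand = solve-∀ polyRing
  collapse : ∀ q y → (oneP +P negP q) +P q *P (oneP +P negP y) ≈ oneP +P negP (q *P y)
  collapse = solve-∀ polyRing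

factP : ℕ → Poly
factP zero = oneP
factP (suc n) = factP n *P intP (suc n)

nonZeroConst-factP : ∀ n → NonZeroConst (factP n)
nonZeroConst-factP zero = nonZeroConst-oneP
nonZeroConst-factP (suc n) = nonZeroConst-*P (nonZeroConst-factP n) (nonZeroConst λ ())

binomP : ℕ → ℕ → Poly
binomP zero zero = oneP
binomP zero (suc k) = []
binomP (suc n) zero = oneP
binomP (suc n) (suc k) = binomP n (suc k) +P qpow (n ∸ k) *P binomP n k

binomP-n0≡1 : ∀ n → binomP n 0 ≡ oneP
binomP-n0≡1 zero = refl
binomP-n0≡1 (suc n) = refl

binomP-n<k≈0 : ∀ {n k} → n < k → binomP n k ≈ []
binomP-n<k≈0 {zero} {suc k} _ = ≈-refl
binomP-n<k≈0 {suc n} {suc k} (s≤s n<k) =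
  +P-cong (binomP-n<k≈0 (ℕ.m<n⇒m<1+n n<k)) (*P-zeroʳ-≈ (qpow (n ∸ k)) (binomP-n<k≈0 n<k))

binomP-nn≈1 : ∀ n → binomP n n ≈ oneP
binomP-nn≈1 zero = ≈-refl
binomP-nn≈1 (suc n) = begin
  binomP n (suc n) +P qpow (n ∸ n) *P binomP n n
    ≈⟨ +P-cong (binomP-n<k≈0 (ℕ.n<1+n n)) (*P-congˡ (qpow (n ∸ n)) (binomP-nn≈1 n)) ⟩
  qpow (n ∸ n) *P oneP   ≈⟨ ≡⇒≈ (cong (λ k → qpow k *P oneP) (ℕ.n∸n≡0 n)) ⟩
  oneP *P oneP           ≈⟨ P.*-identityˡ oneP ⟩
  oneP                   ∎
  where open ≈-Reasoning

factP-binomP : ∀ a b {n} → a + b ≡ n → factP a *P factP b *P binomP n a ≈ factP n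
factP-binomP zero b refl rewrite binomP-n0≡1 b = begin
  oneP *P factP b *P oneP   ≈⟨ P.*-identityʳ _ ⟩
  oneP *P factP b           ≈⟨ P.*-identityˡ _ ⟩
  factP b                   ∎
  where open ≈-Reasoning
factP-binomP (suc a) zero refl rewrite ℕ.+-identityʳ a = begin
  factP (suc a) *P oneP *P binomP (suc a) (suc a)   ≈⟨ *P-congˡ (factP (suc a) *P oneP) (binomP-nn≈1 (suc a)) ⟩
  factP (suc a) *P oneP *P oneP                     ≈⟨ ≈-trans (P.*-identityʳ _) (P.*-identityʳ _) ⟩
  factP (suc a)                                     ∎
  where open ≈-Reasoning
factP-binomP (suc a) (suc b) refl = begin
  Fa *P [a+1] *P (Fb *P [b+1]) *P (B₁ +P qpow (n ∸ a) *P B₂)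
    ≈⟨ *P-congˡ (Fa *P [a+1] *P (Fb *P [b+1]))
                (+P-congˡ B₁ (*P-congʳ B₂ (≡⇒≈ (cong qpow (ℕ.m+n∸m≡n a (suc b)))))) ⟩
  Fa *P [a+1] *P (Fb *P [b+1]) *P (B₁ +P qpow (suc b) *P B₂)
    ≈⟨ regroup Fa [a+1] Fb [b+1] B₁ B₂ (qpow (suc b)) ⟩
  [b+1] *P (Fa *P [a+1] *P Fb *P B₁) +P qpow (suc b) *P [a+1] *P (Fa *P (Fb *P [b+1]) *P B₂)
    ≈⟨ +P-cong (*P-congˡ [b+1] (factP-binomP (suc a) b (sym (ℕ.+-suc a b))))
               (*P-congˡ (qpow (suc b) *P [a+1]) (factP-binomP a (suc b) refl)) ⟩
  [b+1] *P factP n +P qpow (suc b) *P [a+1] *P factP n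
    ≈⟨ factor [b+1] (qpow (suc b)) [a+1] (factP n) ⟩
  (intP (suc b) +P qpow (suc b) *P intP (suc a)) *P factP n
    ≈⟨ *P-congʳ (factP n) (≈-sym (intP-+ (suc b) (suc a))) ⟩
  intP (suc b + suc a) *P factP n
    ≈⟨ ≡⇒≈ (cong (λ k → intP k *P factP n) (ℕ.+-comm (suc b) (suc a))) ⟩
  intP (suc n) *P factP n
    ≈⟨ P.*-comm (intP (suc n)) (factP n) ⟩
  factP (suc n) ∎
  where
  open ≈-Reasoning
  n = a + suc b
  Fa = factP a
  Fb = factP b
  [a+1] = intP (suc a)
  [b+1] = intP (suc b)
  B₁ = binomP n (suc a)
  B₂ = binomP n a
  regroup : ∀ Fa [a+1] Fb [b+1] B₁ B₂ Q →
    Fa *P [a+1] *P (Fb *P [b+1]) *P (B₁ +P Q *P B₂)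
      ≈ [b+1] *P (Fa *P [a+1] *P Fb *P B₁) +P Q *P [a+1] *P (Fa *P (Fb *P [b+1]) *P B₂)
  regroup = solve-∀ polyRing
  factor : ∀ x q y F → x *P F +P q *P y *P F ≈ (x +P q *P y) *P F
  factor = solve-∀ polyRing

binomP-sym : ∀ a b → binomP (a + b) b ≈ binomP (a + b) a
binomP-sym a b = *P-cancelʳ (nonZeroConst-*P (nonZeroConst-factP a) (nonZeroConst-factP b)) (begin
  binomP (a + b) b *P (factP a *P factP b)    ≈⟨ swap (binomP (a + b) b) (factP a) (factP b) ⟩
  factP b *P factP a *P binomP (a + b) b      ≈⟨ factP-binomP b a (ℕ.+-comm b a) ⟩
  factP (a + b)                               ≈⟨ factP-binomP a b refl ⟨
  factP a *P factP b *P binomP (a + b) a      ≈⟨ P.*-comm (factP a *P factP b) (binomP (a + b) a) ⟩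
  binomP (a + b) a *P (factP a *P factP b)    ∎)
  where
  open ≈-Reasoning
  swap : ∀ x y z → x *P (y *P z) ≈ z *P y *P x
  swap = solve-∀ polyRing

sumP : (ℕ → Poly) → ℕ → Poly
sumP f zero = []
sumP f (suc n) = f 0 +P sumP (f ∘ suc) n

syntax sumP (λ i → e) n = ∑[ i < n ] e

sumP-cong : ∀ {f g} n → (∀ i → i < n → f i ≈ g i) → sumP f n ≈ sumP g n
sumP-cong zero f≈g = ≈-refl
sumP-cong (suc n) f≈g = +P-cong (f≈g 0 (s≤s z≤n)) (sumP-cong n λ i i<n → f≈g (suc i) (s≤s i<n))

sumP-≈[] : ∀ {f} n → (∀ i → i < n → f i ≈ []) → sumP f n ≈ []
sumP-≈[] n f≈0 = ≈-trans (sumP-cong n f≈0) (sumP-[] n)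
  where
  sumP-[] : ∀ n → sumP (λ _ → []) n ≈ []
  sumP-[] zero = ≈-refl
  sumP-[] (suc n) = sumP-[] n

sumP-+P : ∀ f g n → sumP (λ i → f i +P g i) n ≈ sumP f n +P sumP g n
sumP-+P f g zero = ≈-refl
sumP-+P f g (suc n) = ≈-trans (+P-congˡ (f 0 +P g 0) (sumP-+P (f ∘ suc) (g ∘ suc) n))
                              (+P-interchange (f 0) (g 0) (sumP (f ∘ suc) n) (sumP (g ∘ suc) n))

*P-sumP : ∀ c f n → c *P sumP f n ≈ sumP (λ i → c *P f i) n
*P-sumP c f zero = *P-zeroʳ c
*P-sumP c f (suc n) = ≈-trans (*P-distribˡ c (f 0) (sumP (f ∘ suc) n)) (+P-congˡ (c *P f 0) (*P-sumP c (f ∘ suc) n))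

sumP-split : ∀ f a b → sumP f (a + b) ≈ sumP f a +P sumP (λ i → f (a + i)) b
sumP-split f zero b = ≈-refl
sumP-split f (suc a) b = ≈-trans (+P-congˡ (f 0) (sumP-split (f ∘ suc) a b))
                                 (≈-sym (+P-assoc (f 0) (sumP (f ∘ suc) a) (sumP (λ i → f (suc a + i)) b)))

sumP-vanishing-tail : ∀ f {m n} → m ≤ n → (∀ i → m ≤ i → i < n → f i ≈ []) → sumP f n ≈ sumP f m
sumP-vanishing-tail f {m} m≤n tail≈0 with ℕ.m≤n⇒∃[o]m+o≡n m≤n
... | d , refl = begin
  sumP f (m + d)
    ≈⟨ sumP-split f m d ⟩
  sumP f m +P sumP (λ i → f (m + i)) d
    ≈⟨ +P-congˡ (sumP f m) (sumP-≈[] d λ i i<d → tail≈0 (m + i) (ℕ.m≤m+n m i) (ℕ.+-monoʳ-< m i<d)) ⟩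
  sumP f m +P []
    ≈⟨ +P-identityʳ (sumP f m) ⟩
  sumP f m                                ∎
  where open ≈-Reasoning

sumP-swap : ∀ (f : ℕ → ℕ → Poly) m n → ∑[ i < m ] sumP (f i) n ≈ ∑[ j < n ] ∑[ i < m ] f i j
sumP-swap f zero n = ≈-sym (sumP-≈[] n λ _ _ → ≈-refl)
sumP-swap f (suc m) n = ≈-trans (+P-congˡ (sumP (f 0) n) (sumP-swap (f ∘ suc) m n))
                                (≈-sym (sumP-+P (f 0) (λ j → ∑[ i < m ] f (suc i) j) n))

infix 4 _≃_
record _≃_ (x y : Frac) : Set where
  constructor cross
  field cross-≈ : num x *P den y ≈ num y *P den x
open _≃_

≃-refl : ∀ {x} → x ≃ x
≃-refl = cross ≈-refl

≃-sym : ∀ {x y} → x ≃ y → y ≃ x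
≃-sym (cross p) = cross (≈-sym p)

≃-trans : ∀ {x y z} → NonZeroConst (den y) → x ≃ y → y ≃ z → x ≃ z
≃-trans {a / b} {c / d} {e / f} d₀≢0 (cross ad≈cb) (cross cf≈ed) = cross (*P-cancelʳ d₀≢0 (begin
  a *P f *P d   ≈⟨ swap₂₃ a f d ⟩
  a *P d *P f   ≈⟨ *P-congʳ f ad≈cb ⟩
  c *P b *P f   ≈⟨ swap₂₃ c b f ⟩
  c *P f *P b   ≈⟨ *P-congʳ b cf≈ed ⟩
  e *P d *P b   ≈⟨ swap₂₃ e d b ⟩
  e *P b *P d   ∎))
  where
  open ≈-Reasoning
  swap₂₃ : ∀ x y z → x *P y *P z ≈ x *P z *P y
  swap₂₃ = solve-∀ polyRing

+F-cong : ∀ {x x′ y y′} → x ≃ x′ → y ≃ y′ → x +F y ≃ x′ +F y′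
+F-cong {a / b} {a′ / b′} {c / d} {c′ / d′} (cross p) (cross q) = cross (begin
  (a *P d +P c *P b) *P (b′ *P d′)                       ≈⟨ expand a b c d b′ d′ ⟩
  a *P b′ *P (d *P d′) +P c *P d′ *P (b *P b′)           ≈⟨ +P-cong (*P-congʳ (d *P d′) p) (*P-congʳ (b *P b′) q) ⟩
  a′ *P b *P (d *P d′) +P c′ *P d *P (b *P b′)           ≈⟨ collect a′ b c′ d b′ d′ ⟩
  (a′ *P d′ +P c′ *P b′) *P (b *P d)                     ∎)
  where
  open ≈-Reasoning
  expand : ∀ a b c d b′ d′ → (a *P d +P c *P b) *P (b′ *P d′) ≈ a *P b′ *P (d *P d′) +P c *P d′ *P (b *P b′)
  expand = solve-∀ polyRing
  collect : ∀ a′ b c′ d b′ d′ → a′ *P b *P (d *P d′) +P c′ *P d *P (b *P b′) ≈ (a′ *P d′ +P c′ *P b′) *P (b *P d)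
  collect = solve-∀ polyRing

*F-cong : ∀ {x x′ y y′} → x ≃ x′ → y ≃ y′ → x *F y ≃ x′ *F y′
*F-cong {a / b} {a′ / b′} {c / d} {c′ / d′} (cross p) (cross q) = cross (begin
  a *P c *P (b′ *P d′)     ≈⟨ interchange a c b′ d′ ⟩
  a *P b′ *P (c *P d′)     ≈⟨ P.*-cong p q ⟩
  a′ *P b *P (c′ *P d)     ≈⟨ interchange a′ b c′ d ⟩
  a′ *P c′ *P (b *P d)     ∎)
  where
  open ≈-Reasoning
  interchange : ∀ w x y z → w *P x *P (y *P z) ≈ w *P y *P (x *P z)
  interchange = solve-∀ polyRing

÷F-cong : ∀ {x x′ y y′} → x ≃ x′ → y ≃ y′ → x ÷F y ≃ x′ ÷F y′
÷F-cong {a / b} {a′ / b′} {c / d} {c′ / d′} (cross p) (cross q) = cross (begin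
  a *P d *P (b′ *P c′)     ≈⟨ regroup a d b′ c′ ⟩
  a *P b′ *P (c′ *P d)     ≈⟨ P.*-cong p (≈-sym q) ⟩
  a′ *P b *P (c *P d′)     ≈⟨ regroup′ a′ b c d′ ⟩
  a′ *P d′ *P (b *P c)     ∎)
  where
  open ≈-Reasoning
  regroup : ∀ a d b′ c′ → a *P d *P (b′ *P c′) ≈ a *P b′ *P (c′ *P d)
  regroup = solve-∀ polyRing
  regroup′ : ∀ a′ b c d′ → a′ *P b *P (c *P d′) ≈ a′ *P d′ *P (b *P c)
  regroup′ = solve-∀ polyRing

poly : Poly → Frac
poly p = p / oneP

*F-poly : ∀ x y {f g} → x ≃ poly f → y ≃ poly g → x *F y ≃ poly (f *P g)
*F-poly x y {f} {g} x≃f y≃g = ≃-trans (nonZeroConst-*P nonZeroConst-oneP nonZeroConst-oneP) (*F-cong x≃f y≃g)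
  (cross (*P-congˡ (f *P g) (P.*-identityʳ oneP)))

qint≃intP : ∀ n → qint n ≃ poly (intP n)
qint≃intP n = cross (≈-trans (P.*-identityʳ _) (≈-sym (intP-*-1-q n)))

qfact≃factP : ∀ n → qfact n ≃ poly (factP n)
qfact≃factP zero = ≃-refl
qfact≃factP (suc n) = *F-poly (qfact n) (qint (suc n)) (qfact≃factP n) (qint≃intP (suc n))

qbinom≃binomP : ∀ n k → qbinom n k ≃ poly (binomP n k)
qbinom≃binomP n k with k ≤? n
... | yes k≤n = ≃-trans den₀≢0 (÷F-cong (qfact≃factP n) (*F-cong (qfact≃factP k) (qfact≃factP (n ∸ k)))) (cross (begin
    factP n *P (oneP *P oneP) *P oneP                    ≈⟨ drop-ones (factP n) ⟩
    factP n                                              ≈⟨ factP-binomP k (n ∸ k) (ℕ.m+[n∸m]≡n k≤n) ⟨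
    factP k *P factP (n ∸ k) *P binomP n k               ≈⟨ reorder (factP k *P factP (n ∸ k)) (binomP n k) ⟩
    binomP n k *P (oneP *P (factP k *P factP (n ∸ k)))   ∎))
  where
  open ≈-Reasoning
  den₀≢0 = nonZeroConst-*P (nonZeroConst-*P nonZeroConst-oneP nonZeroConst-oneP)
                           (nonZeroConst-*P (nonZeroConst-factP k) (nonZeroConst-factP (n ∸ k)))
  drop-ones : ∀ x → x *P (oneP *P oneP) *P oneP ≈ x
  drop-ones = solve-∀ polyRing
  reorder : ∀ x y → x *P y ≈ y *P (oneP *P x)
  reorder = solve-∀ polyRing
... | no k≰n = cross (≈-sym (*P-zeroˡ-≈ oneP (binomP-n<k≈0 (ℕ.≰⇒> k≰n))))

Cq≃ : ∀ m n → Cq m n ≃ (factP (2 * m + 1) *P factP (2 * n)) / (factP (m + n + 1) *P factP m *P factP n)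
Cq≃ m n = ≃-trans den₀≢0
  (÷F-cong (*F-cong (qfact≃factP (2 * m + 1)) (qfact≃factP (2 * n)))
           (*F-cong (*F-cong (qfact≃factP (m + n + 1)) (qfact≃factP m)) (qfact≃factP n)))
  (cross (drop-ones (factP (2 * m + 1) *P factP (2 * n)) (factP (m + n + 1) *P factP m *P factP n)))
  where
  den₀≢0 = nonZeroConst-*P (nonZeroConst-*P nonZeroConst-oneP nonZeroConst-oneP)
             (nonZeroConst-*P (nonZeroConst-*P (nonZeroConst-factP (m + n + 1)) (nonZeroConst-factP m)) (nonZeroConst-factP n))
  drop-ones : ∀ x y → x *P (oneP *P oneP *P oneP) *P y ≈ x *P (oneP *P oneP *P y)
  drop-ones = solve-∀ polyRing

foldr-+F≃ : ∀ {D} → NonZeroConst D → ∀ (f : ℕ → Frac) (g : ℕ → Poly) h n →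
  (∀ i → i < n → f (h i) ≃ g i / D) → foldr _+F_ zeroF (map f (applyUpTo h n)) ≃ sumP g n / D
foldr-+F≃ D₀≢0 f g h zero f≃g = cross ≈-refl
foldr-+F≃ {D} D₀≢0 f g h (suc n) f≃g = ≃-trans (nonZeroConst-*P D₀≢0 D₀≢0)
  (+F-cong (f≃g 0 (s≤s z≤n)) (foldr-+F≃ D₀≢0 f (g ∘ suc) (h ∘ suc) n λ i i<n → f≃g (suc i) (s≤s i<n)))
  (cross (common-denominator (g 0) (sumP (g ∘ suc) n) D))
  where
  common-denominator : ∀ x y d → (x *P d +P y *P d) *P d ≈ (x +P y) *P (d *P d)
  common-denominator = solve-∀ polyRing

sumF≃sumP : ∀ {D} → NonZeroConst D → ∀ a b (f : ℕ → Frac) (g : ℕ → Poly) →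
  (∀ i → i < suc b ∸ a → f (a + i) ≃ g i / D) → sumF a b f ≃ sumP g (suc b ∸ a) / D
sumF≃sumP D₀≢0 a b f g = foldr-+F≃ D₀≢0 (λ i → f (a + i)) g id (suc b ∸ a)

vandermondeTerm : ℕ → ℕ → ℕ → ℕ → Poly
vandermondeTerm a r c k = qpow (k * (c + k)) *P binomP a k *P binomP (r + c) (c + k)

vandermondeTerm-r<k≈0 : ∀ a {r} c {k} → r < k → vandermondeTerm a r c k ≈ []
vandermondeTerm-r<k≈0 a {r} c {k} r<k = *P-zeroʳ-≈ (qpow (k * (c + k)) *P binomP a k)
  (binomP-n<k≈0 (subst (_< c + k) (ℕ.+-comm c r) (ℕ.+-monoʳ-< c r<k)))

vandermondeTerm-shift : ∀ a r c k →
  qpow (suc k * (c + suc k)) *P qpow (a ∸ k) *P binomP a k *P binomP (suc r + c) (c + suc k)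
    ≈ qpow (a + suc c) *P vandermondeTerm a r (suc c) k
vandermondeTerm-shift a r c k with ℕ.≤-<-connex k a
... | inj₂ a<k = ≈-trans (*P-zero-middle (qpow (suc k * (c + suc k)) *P qpow (a ∸ k)) (binomP (suc r + c) (c + suc k)) B≈0)
                 (≈-sym (*P-zeroʳ-≈ (qpow (a + suc c)) (*P-zero-middle (qpow (k * (suc c + k))) (binomP (r + suc c) (suc c + k)) B≈0)))
  where
  B≈0 = binomP-n<k≈0 a<k
... | inj₁ k≤a with ℕ.m≤n⇒∃[o]m+o≡n k≤a
... | t , refl = begin
  qpow (suc k * (c + suc k)) *P qpow (k + t ∸ k) *P binomP (k + t) k *P binomP (suc r + c) (c + suc k)
    ≈⟨ ≡⇒≈ (cong₂ (λ e n → qpow (suc k * (c + suc k)) *P qpow e *P binomP (k + t) k *P binomP n (c + suc k))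
                  (ℕ.m+n∸m≡n k t) (sym (ℕ.+-suc r c))) ⟩
  qpow (suc k * (c + suc k)) *P qpow t *P B *P binomP (r + suc c) (c + suc k)
    ≈⟨ *P-congʳ (binomP (r + suc c) (c + suc k)) (*P-congʳ B (≈-sym (qpow-+ (suc k * (c + suc k)) t))) ⟩
  qpow (suc k * (c + suc k) + t) *P B *P binomP (r + suc c) (c + suc k)
    ≈⟨ ≡⇒≈ (cong₂ (λ e j → qpow e *P B *P binomP (r + suc c) j) (exponent k t c) (ℕ.+-suc c k)) ⟩
  qpow ((k + t + suc c) + k * (suc c + k)) *P B *P binomP (r + suc c) (suc c + k)
    ≈⟨ *P-congʳ (binomP (r + suc c) (suc c + k)) (*P-congʳ B (qpow-+ (k + t + suc c) (k * (suc c + k)))) ⟩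
  qpow (k + t + suc c) *P qpow (k * (suc c + k)) *P B *P binomP (r + suc c) (suc c + k)
    ≈⟨ reassoc (qpow (k + t + suc c)) (qpow (k * (suc c + k))) B (binomP (r + suc c) (suc c + k)) ⟩
  qpow (k + t + suc c) *P vandermondeTerm (k + t) r (suc c) k ∎
  where
  open ≈-Reasoning
  B = binomP (k + t) k
  exponent : ∀ k t c → suc k * (c + suc k) + t ≡ (k + t + suc c) + k * (suc c + k)
  exponent = ℕ-Solver.solve-∀
  reassoc : ∀ w x y z → w *P x *P y *P z ≈ w *P (x *P y *P z)
  reassoc = solve-∀ polyRing

vandermondeTerm-pascal : ∀ a r c k →
  vandermondeTerm (suc a) (suc r) c (suc k) ≈ vandermondeTerm a (suc r) c (suc k) +P qpow (a + suc c) *P vandermondeTerm a r (suc c) k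
vandermondeTerm-pascal a r c k =
  ≈-trans (distribute (qpow (suc k * (c + suc k))) (binomP a (suc k)) (qpow (a ∸ k)) (binomP a k) (binomP (suc r + c) (c + suc k)))
          (+P-congˡ (vandermondeTerm a (suc r) c (suc k)) (vandermondeTerm-shift a r c k))
  where
  distribute : ∀ q x q′ y b → q *P (x +P q′ *P y) *P b ≈ q *P x *P b +P q *P q′ *P y *P b
  distribute = solve-∀ polyRing

-- Pascal's rule for [a+1, k] splits the sum into the case a and, after shifting k, the case
-- (a, r-1, c+1); Pascal's rule for [a+r+c+1, r] splits the right-hand side the same way.
q-vandermonde : ∀ a r c → sumP (vandermondeTerm a r c) (suc r) ≈ binomP (a + r + c) r
q-vandermonde zero r c = begin
  oneP *P oneP *P binomP (r + c) (c + 0) +P sumP (vandermondeTerm 0 r c ∘ suc) r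
    ≈⟨ +P-cong (≈-trans (P.*-congʳ (P.*-identityʳ oneP)) (P.*-identityˡ _))
               (sumP-≈[] r λ k _ → *P-zero-middle (qpow (suc k * (c + suc k))) (binomP (r + c) (c + suc k)) ≈-refl) ⟩
  binomP (r + c) (c + 0) +P []
    ≈⟨ +P-identityʳ _ ⟩
  binomP (r + c) (c + 0)
    ≈⟨ ≡⇒≈ (cong (binomP (r + c)) (ℕ.+-identityʳ c)) ⟩
  binomP (r + c) c
    ≈⟨ binomP-sym r c ⟩
  binomP (r + c) r ∎
  where open ≈-Reasoning
q-vandermonde (suc a) zero c = begin
  oneP *P oneP *P binomP c (c + 0) +P []   ≈⟨ +P-identityʳ _ ⟩
  oneP *P oneP *P binomP c (c + 0)         ≈⟨ ≈-trans (P.*-congʳ (P.*-identityʳ oneP)) (P.*-identityˡ _) ⟩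
  binomP c (c + 0)                         ≈⟨ ≡⇒≈ (cong (binomP c) (ℕ.+-identityʳ c)) ⟩
  binomP c c                               ≈⟨ binomP-nn≈1 c ⟩
  oneP                                     ∎
  where open ≈-Reasoning
q-vandermonde (suc a) (suc r) c = begin
  vT (suc a) (suc r) c 0 +P sumP (vT (suc a) (suc r) c ∘ suc) (suc r)
    ≈⟨ +P-cong (≡⇒≈ (cong (λ b → oneP *P b *P binomP (suc r + c) (c + 0)) (sym (binomP-n0≡1 a))))
               (sumP-cong (suc r) λ k _ → vandermondeTerm-pascal a r c k) ⟩
  vT a (suc r) c 0 +P sumP (λ k → vT a (suc r) c (suc k) +P q *P vT a r (suc c) k) (suc r)
    ≈⟨ +P-congˡ (vT a (suc r) c 0) (sumP-+P (vT a (suc r) c ∘ suc) (λ k → q *P vT a r (suc c) k) (suc r)) ⟩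
  vT a (suc r) c 0 +P (sumP (vT a (suc r) c ∘ suc) (suc r) +P sumP (λ k → q *P vT a r (suc c) k) (suc r))
    ≈⟨ ≈-sym (+P-assoc (vT a (suc r) c 0) _ _) ⟩
  sumP (vT a (suc r) c) (suc (suc r)) +P sumP (λ k → q *P vT a r (suc c) k) (suc r)
    ≈⟨ +P-cong (q-vandermonde a (suc r) c) (≈-sym (*P-sumP q (vT a r (suc c)) (suc r))) ⟩
  binomP n (suc r) +P q *P sumP (vT a r (suc c)) (suc r)
    ≈⟨ +P-congˡ (binomP n (suc r)) (*P-congˡ q (q-vandermonde a r (suc c))) ⟩
  binomP n (suc r) +P q *P binomP (a + r + suc c) r
    ≈⟨ ≡⇒≈ (cong₂ (λ e m → binomP n (suc r) +P qpow e *P binomP m r) (sym n∸r) (index a r c)) ⟩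
  binomP n (suc r) +P qpow (n ∸ r) *P binomP n r ∎
  where
  open ≈-Reasoning
  vT = vandermondeTerm
  n = a + suc r + c
  q = qpow (a + suc c)
  index : ∀ a r c → a + r + suc c ≡ a + suc r + c
  index = ℕ-Solver.solve-∀
  n∸r : n ∸ r ≡ a + suc c
  n∸r = trans (cong (_∸ r) (index′ a r c)) (ℕ.m+n∸n≡m (a + suc c) r)
    where
    index′ : ∀ a r c → a + suc r + c ≡ a + suc c + r
    index′ = ℕ-Solver.solve-∀

q-vandermonde-≤ : ∀ a {r n} c → r ≤ n → sumP (vandermondeTerm a r c) (suc n) ≈ binomP (a + r + c) r
q-vandermonde-≤ a {r} c r≤n = ≈-trans
  (sumP-vanishing-tail (vandermondeTerm a r c) (s≤s r≤n) λ k r<k _ → vandermondeTerm-r<k≈0 a c r<k)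
  (q-vandermonde a r c)

term : ℕ → ℕ → ℕ → ℕ → Poly
term N m k j = qpow (j * (suc N + j)) *P binomP (m + suc N) (suc N + j) *P vandermondeTerm (m ∸ j) j (suc N) k

term-j<k≈0 : ∀ N m {k j} → j < k → term N m k j ≈ []
term-j<k≈0 N m {k} {j} j<k =
  *P-zeroʳ-≈ (qpow (j * (suc N + j)) *P binomP (m + suc N) (suc N + j)) (vandermondeTerm-r<k≈0 (m ∸ j) (suc N) j<k)

term-m<k+j≈0 : ∀ N m k j → m < k + j → term N m k j ≈ []
term-m<k+j≈0 N m zero j m<j = *P-zero-middle (qpow (j * (suc N + j))) (vandermondeTerm (m ∸ j) j (suc N) zero)
  (binomP-n<k≈0 (subst (_< suc N + j) (ℕ.+-comm (suc N) m) (ℕ.+-monoʳ-< (suc N) m<j)))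
term-m<k+j≈0 N m (suc k) j m<k+j =
  *P-zeroʳ-≈ (qpow (j * (suc N + j)) *P binomP (m + suc N) (suc N + j))
    (*P-zero-middle (qpow (suc k * (suc N + suc k))) (binomP (j + suc N) (suc N + suc k)) (binomP-n<k≈0 m∸j<k))
  where
  m∸j<k : m ∸ j < suc k
  m∸j<k = ℕ.m<n+o⇒m∸n<o m j (subst (m <_) (ℕ.+-comm (suc k) j) m<k+j)

term-column : ∀ N m j → j ≤ m → ∑[ k < suc m ] term N m k j ≈ vandermondeTerm (m + suc N) m (suc N) j
term-column N m j j≤m = begin
  ∑[ k < suc m ] term N m k j
    ≈⟨ *P-sumP (Q *P B₁) (vandermondeTerm (m ∸ j) j (suc N)) (suc m) ⟨
  Q *P B₁ *P sumP (vandermondeTerm (m ∸ j) j (suc N)) (suc m)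
    ≈⟨ *P-congˡ (Q *P B₁) (q-vandermonde-≤ (m ∸ j) (suc N) j≤m) ⟩
  Q *P B₁ *P binomP (m ∸ j + j + suc N) j
    ≈⟨ *P-congˡ (Q *P B₁) (≡⇒≈ (cong (λ n → binomP (n + suc N) j) (ℕ.m∸n+n≡m j≤m))) ⟩
  Q *P B₁ *P binomP (m + suc N) j
    ≈⟨ swap Q B₁ (binomP (m + suc N) j) ⟩
  vandermondeTerm (m + suc N) m (suc N) j ∎
  where
  open ≈-Reasoning
  Q = qpow (j * (suc N + j))
  B₁ = binomP (m + suc N) (suc N + j)
  swap : ∀ q x y → q *P x *P y ≈ q *P y *P x
  swap = solve-∀ polyRing

term-square : ∀ N m → ∑[ k < suc m ] ∑[ j < suc m ] term N m k j ≈ binomP (2 * (N + suc m)) m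
term-square N m = begin
  ∑[ k < suc m ] ∑[ j < suc m ] term N m k j              ≈⟨ sumP-swap (term N m) (suc m) (suc m) ⟩
  ∑[ j < suc m ] ∑[ k < suc m ] term N m k j              ≈⟨ sumP-cong (suc m) (λ j j≤m → term-column N m j (s≤s⁻¹ j≤m)) ⟩
  sumP (vandermondeTerm (m + suc N) m (suc N)) (suc m)   ≈⟨ q-vandermonde (m + suc N) m (suc N) ⟩
  binomP (m + suc N + m + suc N) m                       ≈⟨ ≡⇒≈ (cong (λ n → binomP n m) (total N m)) ⟩
  binomP (2 * (N + suc m)) m                             ∎
  where
  open ≈-Reasoning
  total : ∀ N m → m + suc N + m + suc N ≡ 2 * (N + suc m)
  total = ℕ-Solver.solve-∀

2*k≡k+k : ∀ k → 2 * k ≡ k + k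
2*k≡k+k k = cong (k +_) (ℕ.+-identityʳ k)

k≤⌊m/2⌋⇒2k≤m : ∀ {k} m → k ≤ ⌊ m /2⌋ → 2 * k ≤ m
k≤⌊m/2⌋⇒2k≤m {k} m k≤⌊m/2⌋ = subst₂ _≤_ (sym (2*k≡k+k k)) (ℕ.⌊n/2⌋+⌈n/2⌉≡n m)
  (ℕ.+-mono-≤ k≤⌊m/2⌋ (ℕ.≤-trans k≤⌊m/2⌋ (ℕ.⌊n/2⌋≤⌈n/2⌉ m)))

⌊m/2⌋<k⇒m<2k : ∀ {k} m → ⌊ m /2⌋ < k → m < 2 * k
⌊m/2⌋<k⇒m<2k {k} m ⌊m/2⌋<k = ℕ.≰⇒> λ 2k≤m → ℕ.<⇒≱ ⌊m/2⌋<k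
  (subst (_≤ ⌊ m /2⌋) (sym (trans (ℕ.n≡⌊n+n/2⌋ k) (cong ⌊_/2⌋ (sym (2*k≡k+k k))))) (ℕ.⌊n/2⌋-mono 2k≤m))

term-row : ∀ N m k → 2 * k ≤ m → ∑[ j < suc m ] term N m k j ≈ ∑[ i < suc (m ∸ 2 * k) ] term N m k (k + i)
term-row N m k 2k≤m with ℕ.m≤n⇒∃[o]m+o≡n 2k≤m
... | t , refl rewrite ℕ.m+n∸m≡n (2 * k) t = begin
  sumP (term N m k) (suc m)
    ≈⟨ ≡⇒≈ (cong (sumP (term N m k)) (length k t)) ⟩
  sumP (term N m k) (k + suc (k + t))
    ≈⟨ sumP-split (term N m k) k (suc (k + t)) ⟩
  sumP (term N m k) k +P ∑[ i < suc (k + t) ] term N m k (k + i)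
    ≈⟨ +P-congʳ _ (sumP-≈[] k λ j j<k → term-j<k≈0 N m j<k) ⟩
  ∑[ i < suc (k + t) ] term N m k (k + i)
    ≈⟨ sumP-vanishing-tail (λ i → term N m k (k + i)) (s≤s (ℕ.m≤n+m t k))
         (λ i t<i _ → term-m<k+j≈0 N m k (k + i) (beyond i t<i)) ⟩
  ∑[ i < suc t ] term N m k (k + i) ∎
  where
  open ≈-Reasoning
  length : ∀ k t → suc (2 * k + t) ≡ k + suc (k + t)
  length = ℕ-Solver.solve-∀
  beyond : ∀ i → t < i → 2 * k + t < k + (k + i)
  beyond i t<i = subst (_< k + (k + i)) (sym (trans (cong (_+ t) (2*k≡k+k k)) (ℕ.+-assoc k k t)))
                       (ℕ.+-monoʳ-< k (ℕ.+-monoʳ-< k t<i))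

term-row-≈[] : ∀ N m k → m < 2 * k → ∑[ j < suc m ] term N m k j ≈ []
term-row-≈[] N m k m<2k = sumP-≈[] (suc m) λ j _ → case ℕ.<-≤-connex j k of λ where
  (inj₁ j<k) → term-j<k≈0 N m j<k
  (inj₂ k≤j) → term-m<k+j≈0 N m k j (ℕ.<-≤-trans m<2k (subst (_≤ k + j) (sym (2*k≡k+k k)) (ℕ.+-monoʳ-≤ k k≤j)))

term-triangle : ∀ N m →
  ∑[ k < suc ⌊ m /2⌋ ] ∑[ i < suc (m ∸ 2 * k) ] term N m k (k + i) ≈ ∑[ k < suc m ] ∑[ j < suc m ] term N m k j
term-triangle N m = begin
  ∑[ k < suc ⌊ m /2⌋ ] ∑[ i < suc (m ∸ 2 * k) ] term N m k (k + i)
    ≈⟨ sumP-cong (suc ⌊ m /2⌋) (λ k k≤⌊m/2⌋ → ≈-sym (term-row N m k (k≤⌊m/2⌋⇒2k≤m m (s≤s⁻¹ k≤⌊m/2⌋)))) ⟩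
  ∑[ k < suc ⌊ m /2⌋ ] ∑[ j < suc m ] term N m k j
    ≈⟨ sumP-vanishing-tail (λ k → ∑[ j < suc m ] term N m k j) (s≤s (ℕ.⌊n/2⌋≤n m))
         (λ k ⌊m/2⌋<k _ → term-row-≈[] N m k (⌊m/2⌋<k⇒m<2k m ⌊m/2⌋<k)) ⟨
  ∑[ k < suc m ] ∑[ j < suc m ] term N m k j ∎
  where open ≈-Reasoning

1+m∸n∸1≡m∸n : ∀ m n → suc m ∸ n ∸ 1 ≡ m ∸ n
1+m∸n∸1≡m∸n m n = trans (ℕ.∸-+-assoc (suc m) n 1) (cong (suc m ∸_) (ℕ.+-comm n 1))

row-length : ∀ k t → suc (suc (2 * k + t) ∸ k ∸ 1) ∸ k ≡ suc t
row-length k t = begin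
  suc (suc (2 * k + t) ∸ k ∸ 1) ∸ k   ≡⟨ cong (λ n → suc n ∸ k) (1+m∸n∸1≡m∸n (2 * k + t) k) ⟩
  suc (2 * k + t ∸ k) ∸ k             ≡⟨ cong (λ n → suc (n ∸ k) ∸ k) 2k+t≡k+[k+t] ⟩
  suc (k + (k + t) ∸ k) ∸ k           ≡⟨ cong (λ n → suc n ∸ k) (ℕ.m+n∸m≡n k (k + t)) ⟩
  suc (k + t) ∸ k                     ≡⟨ cong (_∸ k) (ℕ.+-suc k t) ⟨
  k + suc t ∸ k                       ≡⟨ ℕ.m+n∸m≡n k (suc t) ⟩
  suc t                               ∎
  where
  open ≡-Reasoning
  2k+t≡k+[k+t] : 2 * k + t ≡ k + (k + t)
  2k+t≡k+[k+t] = trans (cong (_+ t) (2*k≡k+k k)) (ℕ.+-assoc k k t)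

rhsSummand : ℕ → ℕ → ℕ → ℕ → Frac
rhsSummand N h k j = qF (k * (N + k + 1) + j * (N + j + 1)) *F qbinom (h ∸ 1) (2 * k) *F qbinom (h ∸ 2 * k ∸ 1) (j ∸ k)

rhsTerm : ℕ → ℕ → ℕ → ℕ → Poly
rhsTerm N m k i = qpow (k * (N + k + 1) + (k + i) * (N + (k + i) + 1)) *P binomP m (2 * k) *P binomP (m ∸ 2 * k) i

rhsSummand≃rhsTerm : ∀ N m k i → rhsSummand N (suc m) k (k + i) ≃ poly (rhsTerm N m k i)
rhsSummand≃rhsTerm N m k i rewrite 1+m∸n∸1≡m∸n m (2 * k) | ℕ.m+n∸m≡n k i =
  *F-poly (qF e *F qbinom m (2 * k)) (qbinom (m ∸ 2 * k) i)
    (*F-poly (qF e) (qbinom m (2 * k)) ≃-refl (qbinom≃binomP m (2 * k)))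
    (qbinom≃binomP (m ∸ 2 * k) i)
  where
  e = k * (N + k + 1) + (k + i) * (N + (k + i) + 1)

qpow-exponents : ∀ N k j →
  qpow (k * (N + k + 1) + j * (N + j + 1)) ≈ qpow (k * (suc N + k)) *P qpow (j * (suc N + j))
qpow-exponents N k j = ≈-trans (≡⇒≈ (cong qpow (exponents N k j))) (qpow-+ (k * (suc N + k)) (j * (suc N + j)))
  where
  exponents : ∀ N k j → k * (N + k + 1) + j * (N + j + 1) ≡ k * (suc N + k) + j * (suc N + j)
  exponents = ℕ-Solver.solve-∀

rhsTerm-cleared : ∀ N k i b → let m = 2 * k + (i + b) in
  factP (2 * k) *P factP (N + suc m) *P rhsTerm N m k i *P (factP i *P factP b)
    ≈ qpow (k * (suc N + k)) *P qpow ((k + i) * (suc N + (k + i))) *P factP m *P factP (m + suc N)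
rhsTerm-cleared N k i b rewrite ℕ.m+n∸m≡n (2 * k) (i + b) = begin
  factP (2 * k) *P Fr *P (Q *P binomP m (2 * k) *P binomP (i + b) i) *P (factP i *P factP b)
    ≈⟨ regroup (factP (2 * k)) Fr Q (binomP m (2 * k)) (binomP (i + b) i) (factP i) (factP b) ⟩
  Q *P Fr *P (factP (2 * k) *P (factP i *P factP b *P binomP (i + b) i) *P binomP m (2 * k))
    ≈⟨ *P-congˡ (Q *P Fr) (*P-congʳ (binomP m (2 * k)) (*P-congˡ (factP (2 * k)) (factP-binomP i b refl))) ⟩
  Q *P Fr *P (factP (2 * k) *P factP (i + b) *P binomP m (2 * k))
    ≈⟨ *P-congˡ (Q *P Fr) (factP-binomP (2 * k) (i + b) refl) ⟩
  Q *P Fr *P factP m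
    ≈⟨ *P-congʳ (factP m) (P.*-cong (qpow-exponents N k (k + i)) (≡⇒≈ (cong factP (N+1+m N m)))) ⟩
  Qk *P Qj *P factP (m + suc N) *P factP m
    ≈⟨ swap (Qk *P Qj) (factP (m + suc N)) (factP m) ⟩
  Qk *P Qj *P factP m *P factP (m + suc N) ∎
  where
  open ≈-Reasoning
  m = 2 * k + (i + b)
  Fr = factP (N + suc m)
  Q = qpow (k * (N + k + 1) + (k + i) * (N + (k + i) + 1))
  Qk = qpow (k * (suc N + k))
  Qj = qpow ((k + i) * (suc N + (k + i)))
  N+1+m : ∀ N m → N + suc m ≡ m + suc N
  N+1+m = ℕ-Solver.solve-∀
  regroup : ∀ F₁ F₂ Q B₁ B₂ Fi Fb →
    F₁ *P F₂ *P (Q *P B₁ *P B₂) *P (Fi *P Fb) ≈ Q *P F₂ *P (F₁ *P (Fi *P Fb *P B₂) *P B₁)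
  regroup = solve-∀ polyRing
  swap : ∀ x y z → x *P y *P z ≈ x *P z *P y
  swap = solve-∀ polyRing

term-cleared : ∀ N k i b → let m = 2 * k + (i + b) in
  factP (N + k + 1) *P factP k *P factP m *P term N m k (k + i) *P (factP i *P factP b)
    ≈ qpow (k * (suc N + k)) *P qpow ((k + i) * (suc N + (k + i))) *P factP m *P factP (m + suc N)
term-cleared N k i b = begin
  F *P (Qj *P B₁ *P (Qk *P binomP (m ∸ (k + i)) k *P binomP (k + i + suc N) (suc N + k))) *P (factP i *P factP b)
    ≈⟨ ≡⇒≈ (cong₂ (λ n l → F *P (Qj *P B₁ *P (Qk *P binomP n k *P l)) *P (factP i *P factP b))
                  (m∸j≡k+b k i b) (cong₂ binomP (j+1+N N k i) (1+N+k N k))) ⟩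
  F *P (Qj *P B₁ *P (Qk *P B₂ *P B₃)) *P (factP i *P factP b)
    ≈⟨ regroup (factP (N + k + 1)) (factP k) (factP m) Qj B₁ Qk B₂ B₃ (factP i) (factP b) ⟩
  Qk *P Qj *P factP m *P B₁ *P (factP k *P factP b *P B₂) *P (factP (N + k + 1) *P factP i *P B₃)
    ≈⟨ P.*-cong (*P-congˡ (Qk *P Qj *P factP m *P B₁) (factP-binomP k b refl))
                (factP-binomP (N + k + 1) i (1+N+k+i N k i)) ⟩
  Qk *P Qj *P factP m *P B₁ *P factP (k + b) *P factP (suc N + (k + i))
    ≈⟨ regroup′ (Qk *P Qj *P factP m) B₁ (factP (k + b)) (factP (suc N + (k + i))) ⟩
  Qk *P Qj *P factP m *P (factP (suc N + (k + i)) *P factP (k + b) *P B₁)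
    ≈⟨ *P-congˡ (Qk *P Qj *P factP m) (factP-binomP (suc N + (k + i)) (k + b) (total N k i b)) ⟩
  Qk *P Qj *P factP m *P factP (m + suc N) ∎
  where
  open ≈-Reasoning
  m = 2 * k + (i + b)
  F = factP (N + k + 1) *P factP k *P factP m
  Qk = qpow (k * (suc N + k))
  Qj = qpow ((k + i) * (suc N + (k + i)))
  B₁ = binomP (m + suc N) (suc N + (k + i))
  B₂ = binomP (k + b) k
  B₃ = binomP (suc N + (k + i)) (N + k + 1)
  m∸j≡k+b : ∀ k i b → 2 * k + (i + b) ∸ (k + i) ≡ k + b
  m∸j≡k+b k i b = trans (cong (_∸ (k + i)) (split k i b)) (ℕ.m+n∸m≡n (k + i) (k + b))
    where
    split : ∀ k i b → 2 * k + (i + b) ≡ k + i + (k + b)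
    split = ℕ-Solver.solve-∀
  j+1+N : ∀ N k i → k + i + suc N ≡ suc N + (k + i)
  j+1+N = ℕ-Solver.solve-∀
  1+N+k : ∀ N k → suc N + k ≡ N + k + 1
  1+N+k = ℕ-Solver.solve-∀
  1+N+k+i : ∀ N k i → N + k + 1 + i ≡ suc N + (k + i)
  1+N+k+i = ℕ-Solver.solve-∀
  total : ∀ N k i b → suc N + (k + i) + (k + b) ≡ 2 * k + (i + b) + suc N
  total = ℕ-Solver.solve-∀
  regroup : ∀ F₁ Fk Fm Qj B₁ Qk B₂ B₃ Fi Fb →
    F₁ *P Fk *P Fm *P (Qj *P B₁ *P (Qk *P B₂ *P B₃)) *P (Fi *P Fb)
      ≈ Qk *P Qj *P Fm *P B₁ *P (Fk *P Fb *P B₂) *P (F₁ *P Fi *P B₃)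
  regroup = solve-∀ polyRing
  regroup′ : ∀ x B y z → x *P B *P y *P z ≈ x *P (z *P y *P B)
  regroup′ = solve-∀ polyRing

factP*rhsTerm≈factP*term : ∀ N m k i → 2 * k ≤ m → i ≤ m ∸ 2 * k →
  factP (2 * k) *P factP (N + suc m) *P rhsTerm N m k i ≈ factP (N + k + 1) *P factP k *P factP m *P term N m k (k + i)
factP*rhsTerm≈factP*term N m k i 2k≤m i≤m∸2k with ℕ.m≤n⇒∃[o]m+o≡n 2k≤m
... | t , refl with ℕ.m≤n⇒∃[o]m+o≡n (subst (i ≤_) (ℕ.m+n∸m≡n (2 * k) t) i≤m∸2k)
... | b , refl = *P-cancelʳ (nonZeroConst-*P (nonZeroConst-factP i) (nonZeroConst-factP b))
                   (≈-trans (rhsTerm-cleared N k i b) (≈-sym (term-cleared N k i b)))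

scaledDen : ℕ → ℕ → Poly
scaledDen N m = factP N *P factP (N + suc m)

nonZeroConst-scaledDen : ∀ N m → NonZeroConst (scaledDen N m)
nonZeroConst-scaledDen N m = nonZeroConst-*P (nonZeroConst-factP N) (nonZeroConst-factP (N + suc m))

scaled : ℕ → ℕ → Poly → Frac
scaled N m p = (factP (2 * N + 1) *P factP m *P p) / scaledDen N m

rhsRow≃ : ∀ N m k → 2 * k ≤ m →
  Cq N k *F sumF k (suc m ∸ k ∸ 1) (rhsSummand N (suc m) k) ≃ scaled N m (∑[ i < suc (m ∸ 2 * k) ] term N m k (k + i))
rhsRow≃ N m k 2k≤m with ℕ.m≤n⇒∃[o]m+o≡n 2k≤m
... | t , refl rewrite ℕ.m+n∸m≡n (2 * k) t = ≃-trans Cq*S-den₀≢0 (*F-cong (Cq≃ N k) inner) (cross (begin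
    F₁ *P factP (2 * k) *P S *P (factP N *P factP (N + suc m))
      ≈⟨ regroup F₁ (factP (2 * k)) S (factP N) (factP (N + suc m)) ⟩
    F₁ *P factP N *P (factP (2 * k) *P factP (N + suc m) *P S)
      ≈⟨ *P-congˡ (F₁ *P factP N) rows ⟩
    F₁ *P factP N *P (factP (N + k + 1) *P factP k *P factP m *P R)
      ≈⟨ regroup′ F₁ (factP N) (factP (N + k + 1)) (factP k) (factP m) R ⟩
    F₁ *P factP m *P R *P (factP (N + k + 1) *P factP N *P factP k *P oneP) ∎))
  where
  open ≈-Reasoning
  F₁ = factP (2 * N + 1)
  S = sumP (rhsTerm N m k) (suc t)
  R = ∑[ i < suc t ] term N m k (k + i)
  Cq*S-den₀≢0 = nonZeroConst-*P (nonZeroConst-*P (nonZeroConst-*P (nonZeroConst-factP (N + k + 1))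
                  (nonZeroConst-factP N)) (nonZeroConst-factP k)) nonZeroConst-oneP
  inner : sumF k (suc m ∸ k ∸ 1) (rhsSummand N (suc m) k) ≃ S / oneP
  inner = subst (λ n → sumF k (suc m ∸ k ∸ 1) (rhsSummand N (suc m) k) ≃ sumP (rhsTerm N m k) n / oneP) (row-length k t)
            (sumF≃sumP nonZeroConst-oneP k (suc m ∸ k ∸ 1) (rhsSummand N (suc m) k) (rhsTerm N m k)
              λ i _ → rhsSummand≃rhsTerm N m k i)
  rows : factP (2 * k) *P factP (N + suc m) *P S ≈ factP (N + k + 1) *P factP k *P factP m *P R
  rows = ≈-trans (*P-sumP (factP (2 * k) *P factP (N + suc m)) (rhsTerm N m k) (suc t))
        (≈-trans (sumP-cong (suc t) λ i i≤t → factP*rhsTerm≈factP*term N m k i (ℕ.m≤m+n (2 * k) t)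
                                                (subst (i ≤_) (sym (ℕ.m+n∸m≡n (2 * k) t)) (s≤s⁻¹ i≤t)))
                 (≈-sym (*P-sumP (factP (N + k + 1) *P factP k *P factP m) (λ i → term N m k (k + i)) (suc t))))
  regroup : ∀ F₁ F₂ S Fn Fr → F₁ *P F₂ *P S *P (Fn *P Fr) ≈ F₁ *P Fn *P (F₂ *P Fr *P S)
  regroup = solve-∀ polyRing
  regroup′ : ∀ F₁ Fn F₃ Fk Fm R → F₁ *P Fn *P (F₃ *P Fk *P Fm *P R) ≈ F₁ *P Fm *P R *P (F₃ *P Fn *P Fk *P oneP)
  regroup′ = solve-∀ polyRing

rhs≃scaled : ∀ N m →
  sumF 0 ⌊ m /2⌋ (λ k → Cq N k *F sumF k (suc m ∸ k ∸ 1) (rhsSummand N (suc m) k)) ≃ scaled N m (binomP (2 * (N + suc m)) m)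
rhs≃scaled N m = ≃-trans (nonZeroConst-scaledDen N m)
  (sumF≃sumP (nonZeroConst-scaledDen N m) 0 ⌊ m /2⌋ _ (λ k → G *P row k)
    λ k k≤⌊m/2⌋ → rhsRow≃ N m k (k≤⌊m/2⌋⇒2k≤m m (s≤s⁻¹ k≤⌊m/2⌋)))
  (cross (*P-congʳ (scaledDen N m) (begin
    ∑[ k < suc ⌊ m /2⌋ ] (G *P row k)                 ≈⟨ *P-sumP G row (suc ⌊ m /2⌋) ⟨
    G *P sumP row (suc ⌊ m /2⌋)                       ≈⟨ *P-congˡ G (term-triangle N m) ⟩
    G *P ∑[ k < suc m ] ∑[ j < suc m ] term N m k j   ≈⟨ *P-congˡ G (term-square N m) ⟩
    G *P binomP (2 * (N + suc m)) m                   ∎)))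
  where
  open ≈-Reasoning
  G = factP (2 * N + 1) *P factP m
  row : ℕ → Poly
  row k = ∑[ i < suc (m ∸ 2 * k) ] term N m k (k + i)

Cq≃scaled : ∀ N m → Cq N (N + suc m) ≃ scaled N m (binomP (2 * (N + suc m)) m)
Cq≃scaled N m = ≃-trans
  (nonZeroConst-*P (nonZeroConst-*P (nonZeroConst-factP (N + r + 1)) (nonZeroConst-factP N)) (nonZeroConst-factP r))
  (Cq≃ N r)
  (cross (begin
    F₁ *P factP (2 * r) *P (factP N *P factP r)
      ≈⟨ *P-congʳ (factP N *P factP r) (*P-congˡ F₁ (≈-sym (factP-binomP m (N + r + 1) (total N m)))) ⟩
    F₁ *P (factP m *P factP (N + r + 1) *P B) *P (factP N *P factP r)
      ≈⟨ regroup F₁ (factP m) (factP (N + r + 1)) B (factP N) (factP r) ⟩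
    F₁ *P factP m *P B *P (factP (N + r + 1) *P factP N *P factP r) ∎))
  where
  open ≈-Reasoning
  r = N + suc m
  F₁ = factP (2 * N + 1)
  B = binomP (2 * r) m
  total : ∀ N m → m + (N + (N + suc m) + 1) ≡ 2 * (N + suc m)
  total = ℕ-Solver.solve-∀
  regroup : ∀ F₁ Fm F₂ B Fn Fr → F₁ *P (Fm *P F₂ *P B) *P (Fn *P Fr) ≈ F₁ *P Fm *P B *P (F₂ *P Fn *P Fr)
  regroup = solve-∀ polyRing

lemma2p3 : (N h : ℕ) → 1 ≤ h →
    Cq N (N + h) ≈F
      sumF 0 ⌊ h ∸ 1 /2⌋ (λ k →
        Cq N k *F
          sumF k (h ∸ k ∸ 1) (λ j →
            qF (k * (N + k + 1) + j * (N + j + 1))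
              *F qbinom (h ∸ 1) (2 * k)
              *F qbinom (h ∸ 2 * k ∸ 1) (j ∸ k)))
lemma2p3 N (suc m) _ =
  coeff-≡ (cross-≈ (≃-trans (nonZeroConst-scaledDen N m) (Cq≃scaled N m) (≃-sym (rhs≃scaled N m))))
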